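{- Let $G$ be a labeled $12$-representable (finite, connected) square grid graph having an end-square $S$ whose vertices, in cyclic order around the $4$-cycle, are labeled $2,3,1,x$ (so $3$ is adjacent to $2$ and $1$, and $1,2$ are opposite corners), such that neither of the nodes labeled $2$ and $3$ belongs to a square other than $S$, while the node labeled $1$ belongs to another square. Then $G$ has a $12$-representant of the form $w=3\,w_1\,2\,w_2\,1\,2\,w_3$, where $w_1,w_2,w_3$ are (possibly empty) words all of whose letters are at least $4$.
   Context: The grid graph is the infinite graph on $\mathbb{Z}^2$ with vertices adjacent iff at Euclidean distance $1$. A square of an induced subgraph $H$ of it is a set of four vertices of $H$ of the form $\{(x,y),(x+1,y),(x,y+1),(x+1,y+1)\}$. A square grid graph is a finite connected induced subgraph of the grid graph in which every vertex and edge lies in some square of it. A square $S$ is an end-square if it has an edge $ab$ such that neither $a$ nor $b$ is a vertex of a square other than $S$. A labeled graph has distinct positive integers as vertices. A word $w$ is a $12$-representant of a labeled graph $G=(V,E)$ if the set of letters of $w$ is $V$ and for all distinct $x,y\in V$: $xy\notin E$ iff some occurrence of $\min(x,y)$ precedes some occurrence of $\max(x,y)$ in $w$; $G$ is $12$-representable if it has a $12$-representant. -}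

module Defs where

open import Data.Nat using (ℕ; _≤_; _⊓_; _⊔_)
open import Data.Integer using (ℤ; _+_; 1ℤ)
open import Data.Product using (_×_; _,_; Σ; ∃; ∃-syntax)
open import Data.Sum using (_⊎_)
open import Data.List using (List; []; _∷_; _++_)
open import Data.List.Membership.Propositional using (_∈_)
open import Relation.Binary.PropositionalEquality using (_≡_)
open import Relation.Binary.Construct.Closure.ReflexiveTransitive using (Star)
open import Relation.Nullary using (¬_)
open import Function.Bundles using (_⇔_)

Point : Set
Point = ℤ × ℤ

Adj : Point → Point → Set
Adj (x₁ , y₁) (x₂ , y₂) =
  (y₁ ≡ y₂ × (x₂ ≡ x₁ + 1ℤ ⊎ x₁ ≡ x₂ + 1ℤ)) ⊎
  (x₁ ≡ x₂ × (y₂ ≡ y₁ + 1ℤ ⊎ y₁ ≡ y₂ + 1ℤ))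

-- The square with lower-left corner s = (x , y) is
-- {(x,y),(x+1,y),(x,y+1),(x+1,y+1)}; InSq s p : p is one of its corners.
InSq : Point → Point → Set
InSq (x , y) p =
  p ≡ (x , y) ⊎ p ≡ (x + 1ℤ , y) ⊎ p ≡ (x , y + 1ℤ) ⊎ p ≡ (x + 1ℤ , y + 1ℤ)

-- An induced subgraph H of the grid is given by its (finite) vertex list.
-- IsSq H s : the square with lower-left corner s is a square of H.
IsSq : List Point → Point → Set
IsSq H (x , y) =
  (x , y) ∈ H × (x + 1ℤ , y) ∈ H × (x , y + 1ℤ) ∈ H × (x + 1ℤ , y + 1ℤ) ∈ H

EdgeH : List Point → Point → Point → Set
EdgeH H p q = p ∈ H × q ∈ H × Adj p q

Connected : List Point → Set
Connected H = (∃[ p ] p ∈ H) × (∀ p q → p ∈ H → q ∈ H → Star (EdgeH H) p q)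

SquareGridGraph : List Point → Set
SquareGridGraph H =
  Connected H ×
  (∀ p → p ∈ H → ∃[ s ] (IsSq H s × InSq s p)) ×
  (∀ p q → EdgeH H p q → ∃[ s ] (IsSq H s × InSq s p × InSq s q))

IsEndSquare : List Point → Point → Set
IsEndSquare H s =
  IsSq H s ×
  ∃[ a ] ∃[ b ] (InSq s a × InSq s b × Adj a b ×
     (∀ s' → IsSq H s' → InSq s' a → s' ≡ s) ×
     (∀ s' → IsSq H s' → InSq s' b → s' ≡ s))

Labeling : List Point → (Point → ℕ) → Set
Labeling H lab =
  (∀ p → p ∈ H → 1 ≤ lab p) ×
  (∀ p q → p ∈ H → q ∈ H → lab p ≡ lab q → p ≡ q)

-- The labeled graph: vertex set = labels, edges between labels of adjacent points.
Vertex : List Point → (Point → ℕ) → ℕ → Set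
Vertex H lab a = ∃[ p ] (p ∈ H × lab p ≡ a)

LEdge : List Point → (Point → ℕ) → ℕ → ℕ → Set
LEdge H lab a b = ∃[ p ] ∃[ q ] (EdgeH H p q × lab p ≡ a × lab q ≡ b)

Precedes : ℕ → ℕ → List ℕ → Set
Precedes a b w = ∃[ u ] ∃[ v ] (w ≡ u ++ (a ∷ v) × b ∈ v)

Is12Rep : List Point → (Point → ℕ) → List ℕ → Set
Is12Rep H lab w =
  (∀ a → (a ∈ w) ⇔ Vertex H lab a) ×
  (∀ a b → Vertex H lab a → Vertex H lab b → ¬ a ≡ b →
     (¬ LEdge H lab a b) ⇔ Precedes (a ⊓ b) (a ⊔ b) w)

Is12Representable : List Point → (Point → ℕ) → Set
Is12Representable H lab = ∃[ w ] Is12Rep H lab w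

module Submission where

-- Start from any 12-representant u of G.  Cut u at the first
-- occurrence of 1 and the part before it at the first occurrence of 2:
-- u = (A ++ B) ++ R, where 2 ∉ A, 1 ∉ A ++ B, B is empty or starts with 2
-- and R starts with 1.  Let Aᴸ, Bᴸ, Rᴸ keep only the letters ≥ 4, and put
--     w = 3 Aᴸ 2 Bᴸ 1 2 Rᴸ.
-- Pairs of large letters keep their relative order, so they are represented
-- as in u.  A large y follows 1 in w iff y ∈ R iff 1 precedes y in u, and y
-- follows 2 in w iff y ∈ B ++ R.  The latter is right because of the
-- geometry of the end-square: every neighbour of 2 with label ≥ 4 is the
-- fourth corner of S, hence also a neighbour of 1, and 3 has no neighbour
-- with label ≥ 4, so 3 may stand in front of everything.

open import Defs
open import Data.Bool using (Bool; true; false; T)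
open import Data.Empty using (⊥-elim)
open import Data.Fin using (Fin; zero; suc)
open import Data.Fin.Properties using (all?) renaming (_≟_ to _≟ᶜ_)
open import Data.Integer using (1ℤ; _+_)
import Data.Integer.Properties as ℤ
open import Data.List using (List; []; _∷_; _++_; filter)
open import Data.List.Membership.Propositional using (_∈_; _∉_)
open import Data.List.Membership.Propositional.Properties
  using (∈-filter⁺; ∈-filter⁻; ∈-++⁺ˡ; ∈-++⁺ʳ; ∈-++⁻)
open import Data.List.Properties using (++-assoc; filter-++; filter-idem)
open import Data.List.Relation.Unary.All using (All)
open import Data.List.Relation.Unary.All.Properties using (all-filter)
open import Data.List.Relation.Unary.Any using (here; there)
open import Data.Nat using (ℕ; zero; suc; s≤s; _≤_; _<_; _⊓_; _⊔_; _≟_; _≤?_; _<?_)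
open import Data.Nat.Properties
  using (<⇒≤; <⇒≢; <⇒≱; <-cmp; ≤-trans; m≤m+n;
         m≤n⇒m⊓n≡m; m≤n⇒m⊔n≡n; m≥n⇒m⊓n≡n; m≥n⇒m⊔n≡m)
open import Data.Product using (_×_; _,_; proj₁; proj₂; ∃-syntax)
open import Data.Sum using (_⊎_; inj₁; inj₂; [_,_])
open import Data.Unit using (tt)
open import Function using (_∘_)
open import Function.Bundles using (_⇔_; mk⇔; module Equivalence)
open import Function.Properties.Equivalence using () renaming (trans to ⇔-trans; sym to ⇔-sym)
open import Relation.Binary.Definitions using (tri<; tri≈; tri>)
open import Relation.Binary.PropositionalEquality
  using (_≡_; _≢_; refl; sym; trans; cong; subst; subst₂; module ≡-Reasoning)
open import Relation.Nullary using (¬_; Dec; yes; no)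
open import Relation.Unary using (Pred; Decidable)
open import Relation.Nullary.Decidable using (T?; ¬?; _×-dec_; _→-dec_; toWitness; from-yes)

open Equivalence using (to; from)

-- 1. Words and the relation Precedes

∉-∷ : ∀ {x c} {l : List ℕ} → x ≢ c → x ∉ l → x ∉ c ∷ l
∉-∷ x≢c x∉l (here x≡c) = x≢c x≡c
∉-∷ x≢c x∉l (there x∈l) = x∉l x∈l

∉-++ : ∀ {x} {k l : List ℕ} → x ∉ k → x ∉ l → x ∉ k ++ l
∉-++ {k = k} x∉k x∉l x∈kl = [ x∉k , x∉l ] (∈-++⁻ k x∈kl)

precedes-∷ : ∀ {a b l} → b ∈ l → Precedes a b (a ∷ l)
precedes-∷ {l = l} b∈l = [] , l , refl , b∈l

precedes-++ʳ : ∀ {a b l} k → Precedes a b l → Precedes a b (k ++ l)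
precedes-++ʳ k (u , v , refl , b∈v) = k ++ u , v , sym (++-assoc k u _) , b∈v

precedes-++ˡ : ∀ {a b k} l → Precedes a b k → Precedes a b (k ++ l)
precedes-++ˡ {a} l (u , v , refl , b∈v) = u , v ++ l , ++-assoc u (a ∷ v) l , ∈-++⁺ˡ b∈v

precedes-∷⁻ : ∀ {a b c l} → Precedes a b (c ∷ l) → (c ≡ a × b ∈ l) ⊎ Precedes a b l
precedes-∷⁻ ([] , v , refl , b∈v) = inj₁ (refl , b∈v)
precedes-∷⁻ (_ ∷ u , v , refl , b∈v) = inj₂ (u , v , refl , b∈v)

precedes-∈ : ∀ {a b l} → Precedes a b l → b ∈ l
precedes-∈ (u , v , refl , b∈v) = ∈-++⁺ʳ u (there b∈v)

precedes-tail : ∀ {a b c l} → Precedes a b (c ∷ l) → b ∈ l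
precedes-tail p = [ proj₂ , precedes-∈ ] (precedes-∷⁻ p)

-- A prefix without the letter a cannot contain the chosen occurrence of a.
precedes-skip : ∀ {a b l} k → a ∉ k → Precedes a b (k ++ l) → Precedes a b l
precedes-skip [] _ p = p
precedes-skip (c ∷ k) a∉ p with precedes-∷⁻ p
... | inj₁ (refl , _) = ⊥-elim (a∉ (here refl))
... | inj₂ p′ = precedes-skip k (a∉ ∘ there) p′

module _ {ℓ} {P : Pred ℕ ℓ} (P? : Decidable P) where

  precedes-filter⁺ : ∀ {a b} l → P a → P b → Precedes a b l → Precedes a b (filter P? l)
  precedes-filter⁺ [] _ _ p = p
  precedes-filter⁺ (c ∷ l) Pa Pb p with P? c | precedes-∷⁻ p
  ... | yes _ | inj₁ (refl , b∈l) = precedes-∷ (∈-filter⁺ P? b∈l Pb)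
  ... | yes _ | inj₂ p′ = precedes-++ʳ (c ∷ []) (precedes-filter⁺ l Pa Pb p′)
  ... | no ¬Pc | inj₁ (refl , _) = ⊥-elim (¬Pc Pa)
  ... | no _ | inj₂ p′ = precedes-filter⁺ l Pa Pb p′

  precedes-filter⁻ : ∀ {a b} l → Precedes a b (filter P? l) → Precedes a b l
  precedes-filter⁻ [] p = p
  precedes-filter⁻ (c ∷ l) p with P? c
  ... | no _ = precedes-++ʳ (c ∷ []) (precedes-filter⁻ l p)
  ... | yes _ with precedes-∷⁻ p
  ...   | inj₁ (refl , b∈l) = precedes-∷ (proj₁ (∈-filter⁻ P? b∈l))
  ...   | inj₂ p′ = precedes-++ʳ (c ∷ []) (precedes-filter⁻ l p′)

-- LedBy x l: every letter of l other than x occurs after some x in l (as when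
-- l is empty or starts with x).
LedBy : ℕ → List ℕ → Set
LedBy x l = ∀ {y} → y ∈ l → y ≢ x → Precedes x y l

ledBy-∷ : ∀ {x l} → LedBy x (x ∷ l)
ledBy-∷ (here refl) y≢x = ⊥-elim (y≢x refl)
ledBy-∷ (there y∈l) _ = precedes-∷ y∈l

first-occurrence : ∀ x l → ∃[ k ] ∃[ m ] (l ≡ k ++ m × x ∉ k × LedBy x m)
first-occurrence x [] = [] , [] , refl , (λ ()) , (λ ())
first-occurrence x (c ∷ l) with c ≟ x
... | yes refl = [] , x ∷ l , refl , (λ ()) , ledBy-∷
... | no c≢x with first-occurrence x l
...   | k , m , refl , x∉k , led = c ∷ k , m , refl , ∉-∷ (c≢x ∘ sym) x∉k , led

large : List ℕ → List ℕ
large = filter (4 ≤?_)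

large-idem : ∀ l → large (large l) ≡ large l
large-idem = filter-idem (4 ≤?_)

large-++ : ∀ k k′ l l′ → large k ≡ large k′ → large l ≡ large l′ → large (k ++ l) ≡ large (k′ ++ l′)
large-++ k k′ l l′ k≈k′ l≈l′ = begin
  large (k ++ l)         ≡⟨ filter-++ (4 ≤?_) k l ⟩
  large k ++ large l     ≡⟨ cong (_++ large l) k≈k′ ⟩
  large k′ ++ large l    ≡⟨ cong (large k′ ++_) l≈l′ ⟩
  large k′ ++ large l′   ≡⟨ filter-++ (4 ≤?_) k′ l′ ⟨
  large (k′ ++ l′)       ∎
  where open ≡-Reasoning

∉-large : ∀ {k} l → k < 4 → k ∉ large l
∉-large l k<4 k∈ = <⇒≱ k<4 (proj₂ (∈-filter⁻ (4 ≤?_) {xs = l} k∈))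

large-∈ : ∀ {y l l′} → 4 ≤ y → large l ≡ large l′ → y ∈ l ⇔ y ∈ l′
large-∈ {y} 4≤y l≈l′ = mk⇔ (move l≈l′) (move (sym l≈l′))
  where
  move : ∀ {k k′} → large k ≡ large k′ → y ∈ k → y ∈ k′
  move k≈k′ y∈k = proj₁ (∈-filter⁻ (4 ≤?_) (subst (y ∈_) k≈k′ (∈-filter⁺ (4 ≤?_) y∈k 4≤y)))

large-precedes : ∀ {a b l l′} → 4 ≤ a → 4 ≤ b → large l ≡ large l′ →
                 Precedes a b l ⇔ Precedes a b l′
large-precedes {a} {b} 4≤a 4≤b l≈l′ = mk⇔ (move l≈l′) (move (sym l≈l′))
  where
  move : ∀ {k k′} → large k ≡ large k′ → Precedes a b k → Precedes a b k′
  move {k} {k′} k≈k′ p =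
    precedes-filter⁻ (4 ≤?_) k′ (subst (Precedes a b) k≈k′ (precedes-filter⁺ (4 ≤?_) k 4≤a 4≤b p))

-- 2. 12-representants, one pair at a time in increasing order

adj-sym : ∀ {p q} → Adj p q → Adj q p
adj-sym (inj₁ (e , inj₁ f)) = inj₁ (sym e , inj₂ f)
adj-sym (inj₁ (e , inj₂ f)) = inj₁ (sym e , inj₁ f)
adj-sym (inj₂ (e , inj₁ f)) = inj₂ (sym e , inj₂ f)
adj-sym (inj₂ (e , inj₂ f)) = inj₂ (sym e , inj₁ f)

ledge-sym : ∀ {H lab a b} → LEdge H lab a b → LEdge H lab b a
ledge-sym (p , q , (p∈H , q∈H , p~q) , lp , lq) = q , p , (q∈H , p∈H , adj-sym p~q) , lq , lp

Ordered12 : List Point → (Point → ℕ) → List ℕ → Set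
Ordered12 H lab w = ∀ {a b} → a < b → Vertex H lab a → Vertex H lab b →
                    (¬ LEdge H lab a b) ⇔ Precedes a b w

rep⇒ordered : ∀ {H lab w} → Is12Rep H lab w → Ordered12 H lab w
rep⇒ordered {H} {lab} {w} (_ , pairs) {a} {b} a<b va vb =
  subst₂ (λ x y → (¬ LEdge H lab a b) ⇔ Precedes x y w)
         (m≤n⇒m⊓n≡m (<⇒≤ a<b)) (m≤n⇒m⊔n≡n (<⇒≤ a<b)) (pairs a b va vb (<⇒≢ a<b))

ordered⇒rep : ∀ {H lab w} → (∀ a → (a ∈ w) ⇔ Vertex H lab a) → Ordered12 H lab w → Is12Rep H lab w
ordered⇒rep {H} {lab} {w} letters ordered = letters , pairs
  where
  pairs : ∀ a b → Vertex H lab a → Vertex H lab b → ¬ a ≡ b →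
          (¬ LEdge H lab a b) ⇔ Precedes (a ⊓ b) (a ⊔ b) w
  pairs a b va vb a≢b with <-cmp a b
  ... | tri< a<b _ _ =
    subst₂ (λ x y → (¬ LEdge H lab a b) ⇔ Precedes x y w)
           (sym (m≤n⇒m⊓n≡m (<⇒≤ a<b))) (sym (m≤n⇒m⊔n≡n (<⇒≤ a<b))) (ordered a<b va vb)
  ... | tri≈ _ a≡b _ = ⊥-elim (a≢b a≡b)
  ... | tri> _ _ b<a =
    subst₂ (λ x y → (¬ LEdge H lab a b) ⇔ Precedes x y w)
           (sym (m≥n⇒m⊓n≡n (<⇒≤ b<a))) (sym (m≥n⇒m⊔n≡m (<⇒≤ b<a)))
           (⇔-trans (mk⇔ (_∘ ledge-sym) (_∘ ledge-sym)) (ordered b<a vb va))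

-- 3. The corners of a square

-- The corners lower-left, lower-right, upper-left and upper-right of a square,
-- indexed by Fin 4 so that claims about all corners are decidable.
Corner : Set
Corner = Fin 4

pattern ll = zero
pattern lr = suc zero
pattern ul = suc (suc zero)
pattern ur = suc (suc (suc zero))

corner : Point → Corner → Point
corner (x , y) ll = (x , y)
corner (x , y) lr = (x + 1ℤ , y)
corner (x , y) ul = (x , y + 1ℤ)
corner (x , y) ur = (x + 1ℤ , y + 1ℤ)

corner-of : ∀ {s p} → InSq s p → ∃[ c ] (p ≡ corner s c)
corner-of (inj₁ p≡) = ll , p≡
corner-of (inj₂ (inj₁ p≡)) = lr , p≡
corner-of (inj₂ (inj₂ (inj₁ p≡))) = ul , p≡
corner-of (inj₂ (inj₂ (inj₂ p≡))) = ur , p≡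

side : Corner → Corner → Bool
side ll lr = true
side lr ll = true
side ll ul = true
side ul ll = true
side lr ur = true
side ur lr = true
side ul ur = true
side ur ul = true
side _  _  = false

n≢n+1 : ∀ n → n ≢ n + 1ℤ
n≢n+1 n n≡ = ℤ.i≢suc[i] (trans n≡ (ℤ.+-comm n 1ℤ))

adj-irrefl : ∀ {x y} → ¬ Adj (x , y) (x , y)
adj-irrefl {x} {y} (inj₁ (_ , inj₁ e)) = n≢n+1 x e
adj-irrefl {x} {y} (inj₁ (_ , inj₂ e)) = n≢n+1 x e
adj-irrefl {x} {y} (inj₂ (_ , inj₁ e)) = n≢n+1 y e
adj-irrefl {x} {y} (inj₂ (_ , inj₂ e)) = n≢n+1 y e

adj-diagonal : ∀ {x₁ y₁ x₂ y₂} → x₁ ≢ x₂ → y₁ ≢ y₂ → ¬ Adj (x₁ , y₁) (x₂ , y₂)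
adj-diagonal _ y≢ (inj₁ (y≡ , _)) = y≢ y≡
adj-diagonal x≢ _ (inj₂ (x≡ , _)) = x≢ x≡

corner-adj : ∀ s c d → Adj (corner s c) (corner s d) ⇔ T (side c d)
corner-adj (x , y) ll lr = mk⇔ _ (λ _ → inj₁ (refl , inj₁ refl))
corner-adj (x , y) lr ll = mk⇔ _ (λ _ → inj₁ (refl , inj₂ refl))
corner-adj (x , y) ll ul = mk⇔ _ (λ _ → inj₂ (refl , inj₁ refl))
corner-adj (x , y) ul ll = mk⇔ _ (λ _ → inj₂ (refl , inj₂ refl))
corner-adj (x , y) lr ur = mk⇔ _ (λ _ → inj₂ (refl , inj₁ refl))
corner-adj (x , y) ur lr = mk⇔ _ (λ _ → inj₂ (refl , inj₂ refl))
corner-adj (x , y) ul ur = mk⇔ _ (λ _ → inj₁ (refl , inj₁ refl))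
corner-adj (x , y) ur ul = mk⇔ _ (λ _ → inj₁ (refl , inj₂ refl))
corner-adj (x , y) ll ll = mk⇔ adj-irrefl λ ()
corner-adj (x , y) lr lr = mk⇔ adj-irrefl λ ()
corner-adj (x , y) ul ul = mk⇔ adj-irrefl λ ()
corner-adj (x , y) ur ur = mk⇔ adj-irrefl λ ()
corner-adj (x , y) ll ur = mk⇔ (adj-diagonal (n≢n+1 x) (n≢n+1 y)) λ ()
corner-adj (x , y) ur ll = mk⇔ (adj-diagonal (n≢n+1 x ∘ sym) (n≢n+1 y ∘ sym)) λ ()
corner-adj (x , y) lr ul = mk⇔ (adj-diagonal (n≢n+1 x ∘ sym) (n≢n+1 y)) λ ()
corner-adj (x , y) ul lr = mk⇔ (adj-diagonal (n≢n+1 x) (n≢n+1 y ∘ sym)) λ ()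

FourthCorner : Corner → Corner → Corner → Corner → Set
FourthCorner a b c d =
  a ≢ b → d ≢ a → d ≢ b → d ≢ c → T (side c a) → T (side c b) →
  ¬ T (side c d) × T (side a d)

fourth-corner : ∀ a b c d → FourthCorner a b c d
fourth-corner = toWitness {a? = all? λ a → all? λ b → all? λ c → all? λ d → decide a b c d} tt
  where
  decide : ∀ a b c d → Dec (FourthCorner a b c d)
  decide a b c d =
    ¬? (a ≟ᶜ b) →-dec ¬? (d ≟ᶜ a) →-dec ¬? (d ≟ᶜ b) →-dec ¬? (d ≟ᶜ c) →-dec
    T? (side c a) →-dec T? (side c b) →-dec (¬? (T? (side c d)) ×-dec T? (side a d))

fourth-corner-adj : ∀ {s p₁ p₂ p₃ q} → InSq s p₁ → InSq s p₂ → InSq s p₃ → InSq s q →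
  p₁ ≢ p₂ → q ≢ p₁ → q ≢ p₂ → q ≢ p₃ → Adj p₃ p₁ → Adj p₃ p₂ → ¬ Adj p₃ q × Adj p₁ q
fourth-corner-adj {s} i₁ i₂ i₃ iq p₁≢p₂ q≢p₁ q≢p₂ q≢p₃ p₃~p₁ p₃~p₂
  with corner-of i₁ | corner-of i₂ | corner-of i₃ | corner-of iq
... | c₁ , refl | c₂ , refl | c₃ , refl | cq , refl
  with fourth-corner c₁ c₂ c₃ cq (p₁≢p₂ ∘ cong (corner s)) (q≢p₁ ∘ cong (corner s))
         (q≢p₂ ∘ cong (corner s)) (q≢p₃ ∘ cong (corner s))
         (to (corner-adj s c₃ c₁) p₃~p₁) (to (corner-adj s c₃ c₂) p₃~p₂)
... | ¬side₃q , side₁q = ¬side₃q ∘ to (corner-adj s c₃ cq) , from (corner-adj s c₁ cq) side₁q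

-- 4. The labels 1, 2, 3 around the end-square

-- Everything the construction of the new representant needs to know about
-- the labeled graph.
record Around123 (H : List Point) (lab : Point → ℕ) : Set where
  field
    no-zero    : ¬ Vertex H lab 0
    vertex₁    : Vertex H lab 1
    vertex₂    : Vertex H lab 2
    vertex₃    : Vertex H lab 3
    edge₁₃     : LEdge H lab 1 3
    edge₂₃     : LEdge H lab 2 3
    nonedge₁₂  : ¬ LEdge H lab 1 2
    isolated₃  : ∀ {y} → 4 ≤ y → ¬ LEdge H lab 3 y
    through₁   : ∀ {y} → 4 ≤ y → LEdge H lab 2 y → LEdge H lab 1 y

corner∈H : ∀ {H s p} → IsSq H s → InSq s p → p ∈ H
corner∈H (ll∈ , _ , _ , _) (inj₁ refl) = ll∈
corner∈H (_ , lr∈ , _ , _) (inj₂ (inj₁ refl)) = lr∈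
corner∈H (_ , _ , ul∈ , _) (inj₂ (inj₂ (inj₁ refl))) = ul∈
corner∈H (_ , _ , _ , ur∈) (inj₂ (inj₂ (inj₂ refl))) = ur∈

large≢small : ∀ {y k} → 4 ≤ y → k < 4 → y ≢ k
large≢small 4≤y k<4 refl = <⇒≱ k<4 4≤y

-- The hypotheses of the theorem yield the facts of Around123: the labels
-- 2 and 3 sit only on the end-square S, so the neighbours of 2 and 3 are
-- corners of S, and the fourth corner is adjacent to 1 but not to 3.
around123 : ∀ {H lab s p₂ p₃ p₁} → SquareGridGraph H → Labeling H lab → IsSq H s →
  InSq s p₂ → InSq s p₃ → InSq s p₁ →
  lab p₂ ≡ 2 → lab p₃ ≡ 3 → lab p₁ ≡ 1 →
  Adj p₃ p₂ → Adj p₃ p₁ → ¬ Adj p₂ p₁ →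
  (∀ s′ → IsSq H s′ → InSq s′ p₂ → s′ ≡ s) →
  (∀ s′ → IsSq H s′ → InSq s′ p₃ → s′ ≡ s) →
  Around123 H lab
around123 {H} {lab} {s} {p₂} {p₃} {p₁} (_ , _ , edge-in-square) (positive , injective) sq
  i₂ i₃ i₁ lab₂ lab₃ lab₁ p₃~p₂ p₃~p₁ p₂≁p₁ only₂ only₃ = record
  { no-zero   = λ { (p , p∈H , lab₀) → <⇒≱ (from-yes (0 <? 1)) (subst (1 ≤_) lab₀ (positive p p∈H)) }
  ; vertex₁   = p₁ , p₁∈H , lab₁
  ; vertex₂   = p₂ , p₂∈H , lab₂
  ; vertex₃   = p₃ , p₃∈H , lab₃
  ; edge₁₃    = p₁ , p₃ , (p₁∈H , p₃∈H , adj-sym p₃~p₁) , lab₁ , lab₃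
  ; edge₂₃    = p₂ , p₃ , (p₂∈H , p₃∈H , adj-sym p₃~p₂) , lab₂ , lab₃
  ; nonedge₁₂ = nonedge₁₂
  ; isolated₃ = isolated₃
  ; through₁  = through₁
  }
  where
  p₁∈H : p₁ ∈ H
  p₁∈H = corner∈H sq i₁
  p₂∈H : p₂ ∈ H
  p₂∈H = corner∈H sq i₂
  p₃∈H : p₃ ∈ H
  p₃∈H = corner∈H sq i₃

  labels-differ : ∀ {p q m n} → lab p ≡ m → lab q ≡ n → m ≢ n → p ≢ q
  labels-differ lp lq m≢n refl = m≢n (trans (sym lp) lq)

  unique : ∀ {p q k} → p ∈ H → q ∈ H → lab p ≡ k → lab q ≡ k → p ≡ q
  unique p∈H q∈H lp lq = injective _ _ p∈H q∈H (trans lp (sym lq))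

  neighbour-in-s : ∀ {p q} → (∀ s′ → IsSq H s′ → InSq s′ p → s′ ≡ s) → EdgeH H p q → InSq s q
  neighbour-in-s only e with edge-in-square _ _ e
  ... | s′ , sq′ , ip , iq with only s′ sq′ ip
  ...   | refl = iq

  -- A neighbour q of p₂ or p₃ with a large label y is the fourth corner of s.
  fourth : ∀ {p q y} → (∀ s′ → IsSq H s′ → InSq s′ p → s′ ≡ s) → EdgeH H p q → lab q ≡ y → 4 ≤ y →
           ¬ Adj p₃ q × Adj p₁ q
  fourth only e lq 4≤y =
    fourth-corner-adj i₁ i₂ i₃ (neighbour-in-s only e) (labels-differ lab₁ lab₂ (λ ()))
      (labels-differ lq lab₁ (large≢small 4≤y (from-yes (1 <? 4))))
      (labels-differ lq lab₂ (large≢small 4≤y (from-yes (2 <? 4))))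
      (labels-differ lq lab₃ (large≢small 4≤y (from-yes (3 <? 4))))
      p₃~p₁ p₃~p₂

  nonedge₁₂ : ¬ LEdge H lab 1 2
  nonedge₁₂ (p , q , (p∈H , q∈H , p~q) , lp , lq)
    with unique p∈H p₁∈H lp lab₁ | unique q∈H p₂∈H lq lab₂
  ... | refl | refl = p₂≁p₁ (adj-sym p~q)

  isolated₃ : ∀ {y} → 4 ≤ y → ¬ LEdge H lab 3 y
  isolated₃ 4≤y (p , q , e@(p∈H , _ , p~q) , lp , lq) with unique p∈H p₃∈H lp lab₃
  ... | refl = proj₁ (fourth only₃ e lq 4≤y) p~q

  through₁ : ∀ {y} → 4 ≤ y → LEdge H lab 2 y → LEdge H lab 1 y
  through₁ 4≤y (p , q , e@(p∈H , q∈H , _) , lp , lq) with unique p∈H p₂∈H lp lab₂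
  ... | refl = p₁ , q , (p₁∈H , q∈H , proj₂ (fourth only₂ e lq 4≤y)) , lab₁ , lq

-- 5. The new representant

module Reshape {H lab} (around : Around123 H lab) (A B R : List ℕ)
  (2∉A : 2 ∉ A) (1∉AB : 1 ∉ A ++ B) (2-leads : LedBy 2 B) (1-leads : LedBy 1 R)
  (rep : Is12Rep H lab ((A ++ B) ++ R)) where

  open Around123 around

  u : List ℕ
  u = (A ++ B) ++ R

  after₁ after₂ after₃ w : List ℕ
  after₁ = 2 ∷ large R
  after₂ = large B ++ 1 ∷ after₁
  after₃ = large A ++ 2 ∷ after₂
  w = 3 ∷ after₃

  small∉after₂ : ∀ {k} → k < 4 → k ≢ 1 → k ≢ 2 → k ∉ after₂
  small∉after₂ k<4 k≢1 k≢2 = ∉-++ (∉-large B k<4) (∉-∷ k≢1 (∉-∷ k≢2 (∉-large R k<4)))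

  small∉after₃ : ∀ {k} → k < 4 → k ≢ 1 → k ≢ 2 → k ∉ after₃
  small∉after₃ k<4 k≢1 k≢2 = ∉-++ (∉-large A k<4) (∉-∷ k≢2 (small∉after₂ k<4 k≢1 k≢2))

  -- The first 1 and the first 2 of w head 1 ∷ after₁ and 2 ∷ after₂, so the
  -- letters following them are those of after₁ and after₂.
  after-1 : ∀ {y} → Precedes 1 y w ⇔ y ∈ after₁
  after-1 = mk⇔
    (precedes-tail ∘ precedes-skip (2 ∷ large B) (∉-∷ (λ ()) (∉-large B (from-yes (1 <? 4))))
                   ∘ precedes-skip (3 ∷ large A) (∉-∷ (λ ()) (∉-large A (from-yes (1 <? 4)))))
    (precedes-++ʳ (3 ∷ large A) ∘ precedes-++ʳ (2 ∷ large B) ∘ precedes-∷)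

  after-2 : ∀ {y} → Precedes 2 y w ⇔ y ∈ after₂
  after-2 = mk⇔
    (precedes-tail ∘ precedes-skip (3 ∷ large A) (∉-∷ (λ ()) (∉-large A (from-yes (2 <? 4)))))
    (precedes-++ʳ (3 ∷ large A) ∘ precedes-∷)

  large-after₁ : large after₁ ≡ large R
  large-after₁ = large-idem R

  large-after₂ : large after₂ ≡ large (B ++ R)
  large-after₂ = large-++ (large B) B (1 ∷ after₁) R (large-idem B) large-after₁

  large-w : large w ≡ large u
  large-w = trans (large-++ (large A) A (2 ∷ after₂) (B ++ R) (large-idem A) large-after₂)
                  (cong large (sym (++-assoc A B R)))

  u-after-1 : ∀ {y} → y ≢ 1 → Precedes 1 y u ⇔ y ∈ R
  u-after-1 y≢1 = mk⇔ (precedes-∈ ∘ precedes-skip (A ++ B) 1∉AB)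
                      (λ y∈R → precedes-++ʳ (A ++ B) (1-leads y∈R y≢1))

  u-after-2 : ∀ {y} → Precedes 2 y u → y ∈ B ++ R
  u-after-2 = precedes-∈ ∘ precedes-skip A 2∉A ∘ subst (Precedes 2 _) (++-assoc A B R)

  u-B-after-2 : ∀ {y} → y ∈ B → y ≢ 2 → Precedes 2 y u
  u-B-after-2 y∈B y≢2 = precedes-++ˡ R (precedes-++ʳ A (2-leads y∈B y≢2))

  ordered-u : Ordered12 H lab u
  ordered-u = rep⇒ordered rep

  nonedge-1 : ∀ {y} → 4 ≤ y → Vertex H lab y → (¬ LEdge H lab 1 y) ⇔ y ∈ R
  nonedge-1 4≤y vy = ⇔-trans (ordered-u (≤-trans (from-yes (2 ≤? 4)) 4≤y) vertex₁ vy)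
                             (u-after-1 (large≢small 4≤y (from-yes (1 <? 4))))

  nonedge-2 : ∀ {y} → 4 ≤ y → Vertex H lab y → (¬ LEdge H lab 2 y) ⇔ y ∈ B ++ R
  nonedge-2 {y} 4≤y vy = mk⇔ (u-after-2 ∘ to rep₂) (λ y∈BR → [ in-B , in-R ] (∈-++⁻ B y∈BR))
    where
    rep₂ : (¬ LEdge H lab 2 y) ⇔ Precedes 2 y u
    rep₂ = ordered-u (≤-trans (from-yes (3 ≤? 4)) 4≤y) vertex₂ vy
    in-B : y ∈ B → ¬ LEdge H lab 2 y
    in-B y∈B = from rep₂ (u-B-after-2 y∈B (large≢small 4≤y (from-yes (2 <? 4))))
    -- a neighbour of 2 is a neighbour of 1, and R avoids the neighbours of 1
    in-R : y ∈ R → ¬ LEdge H lab 2 y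
    in-R y∈R = from (nonedge-1 4≤y vy) y∈R ∘ through₁ 4≤y

  letters-u : ∀ a → (a ∈ u) ⇔ Vertex H lab a
  letters-u = proj₁ rep

  letters-w : ∀ a → (a ∈ w) ⇔ (a ∈ u)
  letters-w 0 = mk⇔ (⊥-elim ∘ ∉-∷ (λ ()) (small∉after₃ (from-yes (0 <? 4)) (λ ()) (λ ())))
                    (⊥-elim ∘ no-zero ∘ to (letters-u 0))
  letters-w 1 = mk⇔ (λ _ → from (letters-u 1) vertex₁)
                    (λ _ → precedes-∈ (from after-2 (∈-++⁺ʳ (large B) (here refl))))
  letters-w 2 = mk⇔ (λ _ → from (letters-u 2) vertex₂) (λ _ → precedes-∈ (from after-1 (here refl)))
  letters-w 3 = mk⇔ (λ _ → from (letters-u 3) vertex₃) (λ _ → here refl)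
  letters-w (suc (suc (suc (suc k)))) = large-∈ (m≤m+n 4 k) large-w

  ordered-w : Ordered12 H lab w
  ordered-w {0} _ v₀ _ = ⊥-elim (no-zero v₀)
  ordered-w {1} {2} _ _ _ = mk⇔ (λ _ → from after-1 (here refl)) (λ _ → nonedge₁₂)
  -- 3 occurs only at the head of w, matching the edges 1-3 and 2-3
  ordered-w {1} {3} _ _ _ =
    mk⇔ (λ ¬e → ⊥-elim (¬e edge₁₃))
        (λ p → ⊥-elim (∉-∷ (λ ()) (∉-large R (from-yes (3 <? 4))) (to after-1 p)))
  ordered-w {2} {3} _ _ _ =
    mk⇔ (λ ¬e → ⊥-elim (¬e edge₂₃))
        (λ p → ⊥-elim (small∉after₂ (from-yes (3 <? 4)) (λ ()) (λ ()) (to after-2 p)))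
  ordered-w {1} {suc (suc (suc (suc k)))} _ _ vb =
    ⇔-trans (nonedge-1 (m≤m+n 4 k) vb) (⇔-sym (⇔-trans after-1 (large-∈ (m≤m+n 4 k) large-after₁)))
  ordered-w {2} {suc (suc (suc (suc k)))} _ _ vb =
    ⇔-trans (nonedge-2 (m≤m+n 4 k) vb) (⇔-sym (⇔-trans after-2 (large-∈ (m≤m+n 4 k) large-after₂)))
  ordered-w {3} {b@(suc (suc (suc (suc k))))} _ _ vb =
    mk⇔ (λ _ → ledBy-∷ (from (letters-w b) (from (letters-u b) vb)) (λ ()))
        (λ _ → isolated₃ (m≤m+n 4 k))
  ordered-w {suc (suc (suc (suc k)))} a<b va vb =
    ⇔-trans (ordered-u a<b va vb)
            (⇔-sym (large-precedes (m≤m+n 4 k) (≤-trans (m≤m+n 4 k) (<⇒≤ a<b)) large-w))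
  ordered-w {1} {0} ()
  ordered-w {1} {1} (s≤s ())
  ordered-w {2} {0} ()
  ordered-w {2} {1} (s≤s ())
  ordered-w {2} {2} (s≤s (s≤s ()))
  ordered-w {3} {0} ()
  ordered-w {3} {1} (s≤s ())
  ordered-w {3} {2} (s≤s (s≤s ()))
  ordered-w {3} {3} (s≤s (s≤s (s≤s ())))

  representant : Is12Rep H lab w
  representant = ordered⇒rep (λ a → ⇔-trans (letters-w a) (letters-u a)) ordered-w

reshape : ∀ {H lab u} → Around123 H lab → Is12Rep H lab u →
  ∃[ w₁ ] ∃[ w₂ ] ∃[ w₃ ]
    (All (4 ≤_) w₁ × All (4 ≤_) w₂ × All (4 ≤_) w₃ × Is12Rep H lab (3 ∷ w₁ ++ 2 ∷ w₂ ++ 1 ∷ 2 ∷ w₃))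
reshape {u = u} around rep with first-occurrence 1 u
... | U , R , refl , 1∉U , 1-leads with first-occurrence 2 U
...   | A , B , refl , 2∉A , 2-leads =
  large A , large B , large R , all-filter (4 ≤?_) A , all-filter (4 ≤?_) B , all-filter (4 ≤?_) R ,
  Reshape.representant around A B R 2∉A 1∉U 2-leads 1-leads rep

lemma10 : (H : List Point) (lab : Point → ℕ) →
    SquareGridGraph H → Labeling H lab → Is12Representable H lab →
    (s p₂ p₃ p₁ : Point) →
    IsSq H s → IsEndSquare H s →
    InSq s p₂ → InSq s p₃ → InSq s p₁ →
    lab p₂ ≡ 2 → lab p₃ ≡ 3 → lab p₁ ≡ 1 →
    Adj p₃ p₂ → Adj p₃ p₁ → ¬ Adj p₂ p₁ →
    (∀ s' → IsSq H s' → InSq s' p₂ → s' ≡ s) →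
    (∀ s' → IsSq H s' → InSq s' p₃ → s' ≡ s) →
    (∃[ s' ] (IsSq H s' × InSq s' p₁ × ¬ s' ≡ s)) →
    ∃[ w₁ ] ∃[ w₂ ] ∃[ w₃ ]
      (All (4 ≤_) w₁ × All (4 ≤_) w₂ × All (4 ≤_) w₃ ×
       Is12Rep H lab (3 ∷ w₁ ++ 2 ∷ w₂ ++ 1 ∷ 2 ∷ w₃))
lemma10 H lab grid labeling (u , rep) s p₂ p₃ p₁ sq _ i₂ i₃ i₁ lab₂ lab₃ lab₁
        p₃~p₂ p₃~p₁ p₂≁p₁ only₂ only₃ _ =
  reshape (around123 grid labeling sq i₂ i₃ i₁ lab₂ lab₃ lab₁ p₃~p₂ p₃~p₁ p₂≁p₁ only₂ only₃) rep
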